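{- Let $P$ be a finite poset and $m\geq 1$ an integer, and let $N=\dim_2(P)+h(P)\,m$. Then $Q_N$ contains a copy of the lexicographic product $P\times Q_m$. In particular, $R(P,Q_m)\leq \dim_2(P)+h(P)\,m$.
   Context: $Q_N$ is the Boolean lattice $2^{[N]}$ ordered by inclusion. An embedding of a poset $P$ into a poset $P'$ is an injective map $f$ with $x\leq y$ in $P$ iff $f(x)\leq f(y)$ in $P'$; its image is a copy of $P$. $\dim_2(P)$ is the smallest $n$ such that $Q_n$ contains a copy of $P$; $h(P)$ is the number of elements in a largest chain of $P$. The lexicographic product $P\times Q$ of posets has ground set the Cartesian product, with $(p_1,q_1)\leq(p_2,q_2)$ iff $p_1<p_2$ in $P$, or ($p_1=p_2$ and $q_1\leq q_2$ in $Q$). For finite posets $P,P'$, $R(P,P')$ is the smallest $N$ such that every red/blue coloring of the elements of $Q_N$ contains a copy of $P$ with all elements red or a copy of $P'$ with all elements blue. -}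

module Defs where

open import Data.Nat using (ℕ)
open import Data.Fin using (Fin)
open import Data.Fin.Subset using (Subset; _⊆_)
open import Data.Bool using (Bool; true; false)
open import Data.Product using (Σ; _×_; _,_)
open import Data.Sum using (_⊎_)
open import Function using (_⇔_)
open import Function.Definitions using (Injective)
open import Relation.Binary.PropositionalEquality using (_≡_; _≢_)
open import Relation.Binary.Structures using (IsPartialOrder)
open import Relation.Binary.Core using (Rel)
open import Data.Nat using (_≤_)

record FinPoset : Set₁ where
  field
    size      : ℕ
    _≼_       : Rel (Fin size) _
    isPartialOrder : IsPartialOrder _≡_ _≼_

-- Boolean lattice Q_N: subsets of [N] (Fin N) ordered by inclusion ⊆.

IsEmbedding : {A : Set} → Rel A _ → (N : ℕ) → (A → Subset N) → Set
IsEmbedding {A} R N f = Injective _≡_ _≡_ f × (∀ x y → (R x y ⇔ (f x ⊆ f y)))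

HasCopy : {A : Set} → Rel A _ → ℕ → Set
HasCopy {A} R N = Σ (A → Subset N) (IsEmbedding R N)

IsDim2 : FinPoset → ℕ → Set
IsDim2 P d = HasCopy _≼_ d × (∀ n → HasCopy _≼_ n → d ≤ n)
  where open FinPoset P

IsChain : (P : FinPoset) → (c : ℕ) → (Fin c → Fin (FinPoset.size P)) → Set
IsChain P c g = Injective _≡_ _≡_ g × (∀ i j → (g i ≼ g j) ⊎ (g j ≼ g i))
  where open FinPoset P

IsHeight : FinPoset → ℕ → Set
IsHeight P h = Σ (Fin h → Fin size) (IsChain P h)
             × (∀ c (g : Fin c → Fin size) → IsChain P c g → c ≤ h)
  where open FinPoset P

LexQ : (P : FinPoset) → (m : ℕ) → Rel (Fin (FinPoset.size P) × Subset m) _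
LexQ P m (p₁ , q₁) (p₂ , q₂) = ((p₁ ≼ p₂) × (p₁ ≢ p₂)) ⊎ ((p₁ ≡ p₂) × (q₁ ⊆ q₂))
  where open FinPoset P

-- Ramsey property behind R(P,P') ≤ N: every red(true)/blue(false) colouring of Q_N
-- has a red copy of P or a blue copy of P'.
RamseyHolds : {A B : Set} → Rel A _ → Rel B _ → ℕ → Set
RamseyHolds {A} {B} R S N = (c : Subset N → Bool) →
    Σ (A → Subset N) (λ f → IsEmbedding R N f × (∀ x → c (f x) ≡ true))
  ⊎ Σ (B → Subset N) (λ f → IsEmbedding S N f × (∀ x → c (f x) ≡ false))

-- Take a copy f of P in Q_d and grade P by rank: r p < h(P) is the length of the longest strictly
-- descending chain below p, so p < p' forces r p < r p'. Encode (p , q) by f p followed by h blocks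
-- of m coordinates, of which the first r p are full, the next is q and the rest are empty. When
-- p < p' the block patterns are nested whatever q and q' are, so this embeds P × Q_m in
-- Q_{d + h m}. A colouring of the copy either has a fibre {p} × Q_m that is entirely blue, or picks
-- a red element in every fibre, and these form a copy of P.
module Submission where

open import Defs
open import Data.Nat using (ℕ; _+_; _*_; _≤_)
open import Data.Fin.Subset using (Subset; _⊆_)
open import Data.Product using (_×_)

open import Data.Bool using (Bool; true; false; _≟_)
open import Data.Bool.Properties using (¬-not)
open import Data.Empty using (⊥-elim)
open import Data.Fin as Fin using (Fin; zero; suc)
open import Data.Fin.Properties using (<-cmp; all?; ¬∀⟶∃¬) renaming (_≟_ to _≟ᶠ_)
open import Data.Fin.Subset using (inside; outside; ⊤; ⊥)
open import Data.Fin.Subset.Properties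
  using (⊆-refl; ⊆-reflexive; ⊆-antisym; ⊆-min; ⊆-max; _⊆?_; drop-∷-⊆; out⊆; in⊆in; anySubset?)
open import Data.List using (List; map; filter; allFin)
open import Data.List.Extrema.Nat using (max; argmax-sel; xs≤max)
open import Data.List.Membership.Propositional.Properties using (∈-map⁺; ∈-map⁻; ∈-filter⁺; ∈-filter⁻; ∈-allFin)
open import Data.List.Properties using (map-cong-local)
open import Data.List.Relation.Unary.All as All using ()
open import Data.List.Relation.Unary.All.Properties using (all-filter)
open import Data.Nat using (zero; suc; _<_; s≤s; z≤n; s<s⁻¹)
open import Data.Nat.Properties using (≤-<-trans)
open import Data.Product using (Σ; _,_; proj₁; proj₂; map₁; map₂)
open import Data.Sum using (_⊎_; inj₁; inj₂)
open import Data.Vec using ([]; _∷_; _++_; here)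
open import Data.Vec.Properties using (++-injectiveˡ; ++-injectiveʳ)
open import Function using (_∘_; id; _⇔_; mk⇔; Equivalence)
import Function.Properties.Equivalence as ⇔
open import Function.Construct.Composition using (_⇔-∘_)
open import Function.Definitions using (Injective)
open import Level using (Level; 0ℓ)
open import Relation.Binary.Core using (Rel)
open import Relation.Binary.Definitions using (Decidable; Transitive; tri<; tri≈; tri>)
open import Relation.Binary.PropositionalEquality using (_≡_; refl; sym; cong; subst)
open import Relation.Binary.Structures using (IsPartialOrder)
import Relation.Binary.Construct.NonStrictToStrict as NonStrictToStrict
open import Relation.Nullary using (Dec; yes; no; contradiction)
import Relation.Nullary.Decidable as Dec

private
  variable
    k n : ℕ
    ℓ : Level

⊆-++⁺ : {a c : Subset n} {b e : Subset k} → a ⊆ c → b ⊆ e → a ++ b ⊆ c ++ e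
⊆-++⁺ {a = []}          {[]}          _   b⊆e = b⊆e
⊆-++⁺ {a = outside ∷ a} {_ ∷ c}       a⊆c b⊆e = out⊆ (⊆-++⁺ (drop-∷-⊆ a⊆c) b⊆e)
⊆-++⁺ {a = inside ∷ a}  {inside ∷ c}  a⊆c b⊆e = in⊆in (⊆-++⁺ (drop-∷-⊆ a⊆c) b⊆e)
⊆-++⁺ {a = inside ∷ a}  {outside ∷ c} a⊆c _   = contradiction (a⊆c here) λ ()

⊆-++⁻ : {a c : Subset n} {b e : Subset k} → a ++ b ⊆ c ++ e → a ⊆ c × b ⊆ e
⊆-++⁻ {a = []}          {[]}          ab⊆ce = (λ ()) , ab⊆ce
⊆-++⁻ {a = outside ∷ a} {_ ∷ c}       ab⊆ce = map₁ out⊆ (⊆-++⁻ (drop-∷-⊆ ab⊆ce))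
⊆-++⁻ {a = inside ∷ a}  {inside ∷ c}  ab⊆ce = map₁ in⊆in (⊆-++⁻ (drop-∷-⊆ ab⊆ce))
⊆-++⁻ {a = inside ∷ a}  {outside ∷ c} ab⊆ce = contradiction (ab⊆ce here) λ ()

block : ∀ h {m} → ℕ → Subset m → Subset (h * m)
block zero    r       q = []
block (suc h) zero    q = q ++ ⊥
block (suc h) (suc r) q = ⊤ ++ block h r q

module _ {m : ℕ} where

  block-⊆-< : ∀ h {r₁ r₂} {q₁ q₂ : Subset m} → r₁ < r₂ → block h r₁ q₁ ⊆ block h r₂ q₂
  block-⊆-< zero    _               = ⊆-refl
  block-⊆-< (suc h) {zero} {suc _} _ = ⊆-++⁺ {m} {h * m} (⊆-max _) (⊆-min _)
  block-⊆-< (suc h) {suc _} {suc _} (s≤s r₁<r₂) = ⊆-++⁺ ⊆-refl (block-⊆-< h r₁<r₂)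

  block-⊆ : ∀ h r {q₁ q₂ : Subset m} → q₁ ⊆ q₂ → block h r q₁ ⊆ block h r q₂
  block-⊆ zero    r       _     = ⊆-refl
  block-⊆ (suc h) zero    q₁⊆q₂ = ⊆-++⁺ q₁⊆q₂ ⊆-refl
  block-⊆ (suc h) (suc r) q₁⊆q₂ = ⊆-++⁺ ⊆-refl (block-⊆ h r q₁⊆q₂)

  block-⊆⁻ : ∀ {h r} {q₁ q₂ : Subset m} → r < h → block h r q₁ ⊆ block h r q₂ → q₁ ⊆ q₂
  block-⊆⁻ {suc h} {zero}  _           b₁⊆b₂ = proj₁ (⊆-++⁻ b₁⊆b₂)
  block-⊆⁻ {suc h} {suc r} (s≤s r<h) b₁⊆b₂ = block-⊆⁻ r<h (proj₂ (⊆-++⁻ {a = ⊤} {⊤} b₁⊆b₂))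

  block-injective : ∀ {h r} {q₁ q₂ : Subset m} → r < h → block h r q₁ ≡ block h r q₂ → q₁ ≡ q₂
  block-injective r<h b₁≡b₂ =
    ⊆-antisym (block-⊆⁻ r<h (⊆-reflexive b₁≡b₂)) (block-⊆⁻ r<h (⊆-reflexive (sym b₁≡b₂)))

Descending : {A : Set} → Rel A ℓ → ∀ {c} → (Fin c → A) → Set ℓ
Descending _≺_ g = ∀ {i j} → i Fin.< j → g j ≺ g i

module Rank {_≺_ : Rel (Fin n) ℓ} (≺-trans : Transitive _≺_) (_≺?_ : Decidable _≺_) where

  DescendingFrom : Fin n → ℕ → Set ℓ
  DescendingFrom p k = Σ (Fin (suc k) → Fin n) λ g → g zero ≡ p × Descending _≺_ g

  singleton : ∀ p → DescendingFrom p 0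
  singleton p = (λ _ → p) , refl , λ { {zero} {zero} () }

  extend : ∀ {p q} → q ≺ p → DescendingFrom q k → DescendingFrom p (suc k)
  extend {p = p} {q} q≺p (g , refl , g↓) = g′ , refl , g′↓
    where
      g′ : Fin (suc (suc _)) → Fin n
      g′ zero    = p
      g′ (suc i) = g i
      g≺p : ∀ j → g j ≺ p
      g≺p zero    = q≺p
      g≺p (suc j) = ≺-trans (g↓ (s≤s z≤n)) q≺p
      g′↓ : Descending _≺_ g′
      g′↓ {zero}  {suc j} _         = g≺p j
      g′↓ {suc i} {suc j} (s≤s i<j) = g↓ i<j

  below : Fin n → List (Fin n)
  below p = filter (_≺? p) (allFin n)

  -- rank k p is the length of a longest descending chain from p with at most k steps.
  rank : ℕ → Fin n → ℕ
  rank zero    p = 0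
  rank (suc k) p = max 0 (map (suc ∘ rank k) (below p))

  rank-step : ∀ k {p q} → q ≺ p → suc (rank k q) ≤ rank (suc k) p
  rank-step k {p} {q} q≺p =
    All.lookup (xs≤max 0 _) (∈-map⁺ (suc ∘ rank k) (∈-filter⁺ (_≺? p) (∈-allFin q) q≺p))

  rank-stable : ∀ {p} → rank k p < k → rank (suc k) p ≡ rank k p
  rank-stable {suc k} {p} rank<k =
    cong (max 0) (map-cong-local (All.map stable-below (all-filter (_≺? p) (allFin n))))
    where
      stable-below : ∀ {q} → q ≺ p → suc (rank (suc k) q) ≡ suc (rank k q)
      stable-below q≺p = cong suc (rank-stable (s<s⁻¹ (≤-<-trans (rank-step k q≺p) rank<k)))

  rank-descending : ∀ k p → DescendingFrom p (rank k p)
  rank-descending zero    p = singleton p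
  rank-descending (suc k) p with argmax-sel id 0 (map (suc ∘ rank k) (below p))
  ... | inj₁ max≡0 = subst (DescendingFrom p) (sym max≡0) (singleton p)
  ... | inj₂ max∈  with ∈-map⁻ (suc ∘ rank k) max∈
  ...   | q , q∈ , max≡ = subst (DescendingFrom p) (sym max≡) (extend q≺p (rank-descending k q))
    where
      q≺p : q ≺ p
      q≺p = proj₂ (∈-filter⁻ (_≺? p) {xs = allFin n} q∈)

module _ {A : Set} {R : Rel A 0ℓ} {N : ℕ} where

  embedding⇒decidable : {f : A → Subset N} → IsEmbedding R N f → Decidable R
  embedding⇒decidable {f} (_ , R⇔⊆) x y = Dec.map (⇔.sym (R⇔⊆ x y)) (f x ⊆? f y)

  isEmbedding-∘ : {B : Set} {S : Rel B 0ℓ} {f : A → Subset N} {g : B → A} →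
                  IsEmbedding R N f → Injective _≡_ _≡_ g → (∀ x y → S x y ⇔ R (g x) (g y)) →
                  IsEmbedding S N (f ∘ g)
  isEmbedding-∘ {g = g} (f-injective , R⇔⊆) g-injective S⇔R =
    g-injective ∘ f-injective , λ x y → R⇔⊆ (g x) (g y) ⇔-∘ S⇔R x y

redInEveryFibre⊎blueFibre : ∀ {m} (c : Fin n → Subset m → Bool) →
                            (∀ p → Σ (Subset m) λ q → c p q ≡ true) ⊎ Σ (Fin n) λ p → ∀ q → c p q ≡ false
redInEveryFibre⊎blueFibre {n} c = split (all? red?)
  where
    red? : ∀ p → Dec (Σ _ λ q → c p q ≡ true)
    red? p = anySubset? λ q → c p q ≟ true
    split : Dec (∀ p → Σ _ λ q → c p q ≡ true) → _
    split (yes red) = inj₁ red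
    split (no ¬red) = inj₂ (map₂ (λ noRed q → ¬-not λ red → noRed (q , red)) (¬∀⟶∃¬ n _ red? ¬red))

module _ (P : FinPoset) where
  open FinPoset P
  open IsPartialOrder isPartialOrder using () renaming (refl to ≼-refl; reflexive to ≼-reflexive)
  open NonStrictToStrict _≡_ _≼_ using (<-trans; <-decidable) renaming (_<_ to _≺_)

  descending⇒chain : ∀ {c} {g : Fin c → Fin size} → Descending _≺_ g → IsChain P c g
  descending⇒chain {g = g} g↓ = g-injective , comparable
    where
      g-injective : Injective _≡_ _≡_ g
      g-injective {i} {j} gi≡gj with <-cmp i j
      ... | tri< i<j _ _ = ⊥-elim (proj₂ (g↓ i<j) (sym gi≡gj))
      ... | tri≈ _ i≡j _ = i≡j
      ... | tri> _ _ j<i = ⊥-elim (proj₂ (g↓ j<i) gi≡gj)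
      comparable : ∀ i j → (g i ≼ g j) ⊎ (g j ≼ g i)
      comparable i j with <-cmp i j
      ... | tri< i<j _ _ = inj₂ (proj₁ (g↓ i<j))
      ... | tri≈ _ refl _ = inj₁ ≼-refl
      ... | tri> _ _ j<i = inj₁ (proj₁ (g↓ j<i))

  grading : ∀ {h} → Decidable _≼_ → IsHeight P h →
            Σ (Fin size → ℕ) λ level → (∀ p → level p < h) × (∀ {p q} → p ≺ q → level p < level q)
  grading {h} _≼?_ (_ , chain≤h) = rank h , rank<h , rank-mono
    where
      open Rank (<-trans isPartialOrder) (<-decidable _≟ᶠ_ _≼?_)
      rank<h : ∀ p → rank h p < h
      rank<h p with rank-descending h p
      ... | g , _ , g↓ = chain≤h _ g (descending⇒chain g↓)
      -- Since every rank is below h, one more step of fuel changes nothing.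
      rank-mono : ∀ {p q} → p ≺ q → rank h p < rank h q
      rank-mono {p} {q} p≺q = subst (suc (rank h p) ≤_) (rank-stable (rank<h q)) (rank-step h p≺q)

  gradedLexCopy : ∀ {d h} m → HasCopy _≼_ d → (level : Fin size → ℕ) → (∀ p → level p < h) →
                  (∀ {p q} → p ≺ q → level p < level q) → HasCopy (LexQ P m) (d + h * m)
  gradedLexCopy {d} {h} m (f , f-injective , ≼⇔⊆) level level<h level-mono =
    encode , encode-injective , λ a b → mk⇔ (lex⇒⊆ a b) (⊆⇒lex a b)
    where
      encode : Fin size × Subset m → Subset (d + h * m)
      encode (p , q) = f p ++ block h (level p) q
      lex⇒⊆ : ∀ a b → LexQ P m a b → encode a ⊆ encode b
      lex⇒⊆ (p₁ , q₁) (p₂ , q₂) (inj₁ p₁≺p₂) =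
        ⊆-++⁺ (Equivalence.to (≼⇔⊆ p₁ p₂) (proj₁ p₁≺p₂)) (block-⊆-< h (level-mono p₁≺p₂))
      lex⇒⊆ (p , q₁) (.p , q₂) (inj₂ (refl , q₁⊆q₂)) = ⊆-++⁺ ⊆-refl (block-⊆ h (level p) q₁⊆q₂)
      ⊆⇒lex : ∀ a b → encode a ⊆ encode b → LexQ P m a b
      ⊆⇒lex (p₁ , q₁) (p₂ , q₂) e₁⊆e₂ with p₁ ≟ᶠ p₂
      ... | no p₁≢p₂ = inj₁ (Equivalence.from (≼⇔⊆ p₁ p₂) (proj₁ (⊆-++⁻ e₁⊆e₂)) , p₁≢p₂)
      ... | yes refl = inj₂ (refl , block-⊆⁻ (level<h p₁) (proj₂ (⊆-++⁻ e₁⊆e₂)))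
      encode-injective : Injective _≡_ _≡_ encode
      encode-injective {p₁ , q₁} {p₂ , q₂} e₁≡e₂ with f-injective (++-injectiveˡ (f p₁) (f p₂) e₁≡e₂)
      ... | refl = cong (p₁ ,_) (block-injective (level<h p₁) (++-injectiveʳ (f p₁) (f p₁) e₁≡e₂))

  lexCopy : ∀ {d h} m → HasCopy _≼_ d → IsHeight P h → HasCopy (LexQ P m) (d + h * m)
  lexCopy m copy@(_ , embedding) height with grading (embedding⇒decidable embedding) height
  ... | level , level<h , level-mono = gradedLexCopy m copy level level<h level-mono

  fibre-⇔ : ∀ {m} p (q₁ q₂ : Subset m) → q₁ ⊆ q₂ ⇔ LexQ P m (p , q₁) (p , q₂)
  fibre-⇔ p q₁ q₂ = mk⇔ (λ q₁⊆q₂ → inj₂ (refl , q₁⊆q₂)) λ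
    { (inj₁ (_ , p≢p))   → contradiction refl p≢p
    ; (inj₂ (_ , q₁⊆q₂)) → q₁⊆q₂ }

  section-⇔ : ∀ {m} (s : Fin size → Subset m) p₁ p₂ → p₁ ≼ p₂ ⇔ LexQ P m (p₁ , s p₁) (p₂ , s p₂)
  section-⇔ s p₁ p₂ = mk⇔ to λ
    { (inj₁ (p₁≼p₂ , _)) → p₁≼p₂
    ; (inj₂ (p₁≡p₂ , _)) → ≼-reflexive p₁≡p₂ }
    where
      to : p₁ ≼ p₂ → LexQ P _ (p₁ , s p₁) (p₂ , s p₂)
      to p₁≼p₂ with p₁ ≟ᶠ p₂
      ... | yes refl = inj₂ (refl , ⊆-refl)
      ... | no p₁≢p₂ = inj₁ (p₁≼p₂ , p₁≢p₂)

  lexCopy⇒ramsey : ∀ {m N} → HasCopy (LexQ P m) N → RamseyHolds _≼_ (_⊆_ {m}) N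
  lexCopy⇒ramsey (e , e-embedding) c with redInEveryFibre⊎blueFibre (λ p q → c (e (p , q)))
  ... | inj₁ red =
    inj₁ (e ∘ (λ p → p , proj₁ (red p)) , isEmbedding-∘ e-embedding (cong proj₁) (section-⇔ (proj₁ ∘ red))
         , proj₂ ∘ red)
  ... | inj₂ (p , blue) = inj₂ (e ∘ (p ,_) , isEmbedding-∘ e-embedding (cong proj₂) (fibre-⇔ p) , blue)

mainTheorem8 : (P : FinPoset) (m d h : ℕ) → 1 ≤ m → IsDim2 P d → IsHeight P h →
    HasCopy (LexQ P m) (d + h * m)
    × RamseyHolds (FinPoset._≼_ P) (_⊆_ {m}) (d + h * m)
mainTheorem8 P m d h _ (copyOfP , _) height = copy , lexCopy⇒ramsey P copy
  where
    copy : HasCopy (LexQ P m) (d + h * m)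
    copy = lexCopy P m copyOfP height
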